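{- Let $f:\{0,1\}^n\to\{0,1\}$ be $\epsilon$-far from being $t$-symmetric. Then every set $J\subseteq[n]$ with $|J|\ge t$ satisfies $\mathrm{SymInf}_f(J)\ge\epsilon$.
   Context: $\mathcal{S}_J$ is the set of permutations of $[n]$ fixing every element outside $J$; $\pi x$ is the vector whose $\pi(i)$-th coordinate is $x_i$. $f$ is $J$-symmetric if $f(\pi x)=f(x)$ for all $x$ and $\pi\in\mathcal{S}_J$, and $t$-symmetric if $J$-symmetric for some $|J|\ge t$. $f$ is $\epsilon$-far from being $t$-symmetric if $\Pr_x[f(x)\ne g(x)]\ge\epsilon$ for every $t$-symmetric $g$. $\mathrm{SymInf}_f(J)=\Pr_{x,\pi}[f(x)\ne f(\pi x)]$ with $x$ uniform in $\{0,1\}^n$ and $\pi$ uniform in $\mathcal{S}_J$.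
   Formalization: The parameter ε ranges over the rationals. -}

module Defs where

open import Data.Nat using (ℕ; zero; suc; _≤_)
open import Data.Bool using (Bool; true; false)
open import Data.Bool.Properties using () renaming (_≟_ to _≟ᵇ_)
open import Data.Fin using (Fin)
open import Data.Fin.Properties using (all?) renaming (_≟_ to _≟ᶠ_)
open import Data.Fin.Subset using (Subset; _∈_; _∉_; ∣_∣)
open import Data.Fin.Subset.Properties using (_∈?_)
open import Data.Vec using (Vec; []; _∷_; lookup; tabulate)
open import Data.List using (List; [_]; concatMap; map; filter; length; cartesianProduct; allFin)
open import Data.Product using (_×_; _,_; Σ; proj₁; proj₂)
open import Data.Integer using (+_)
open import Data.Rational using (ℚ; 0ℚ; _/_)
open import Relation.Binary.PropositionalEquality using (_≡_; _≢_)
open import Relation.Nullary using (Dec; ¬?)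
open import Relation.Nullary.Decidable using (_×-dec_; _→-dec_)
open import Relation.Unary using (Pred; Decidable)
import Agda.Primitive

allVecs : {A : Set} → List A → (n : ℕ) → List (Vec A n)
allVecs xs zero = [ [] ]
allVecs xs (suc n) = concatMap (λ a → map (a ∷_) (allVecs xs n)) xs

Cube : ℕ → Set
Cube n = Vec Bool n

cube : (n : ℕ) → List (Cube n)
cube n = allVecs (true Data.List.∷ false Data.List.∷ Data.List.[]) n

-- ratio c / d (d = 0 never occurs below; it is mapped to 0)
ratio : ℕ → ℕ → ℚ
ratio c zero = 0ℚ
ratio c (suc d) = (+ c) / suc d

-- probability of a decidable event under the uniform distribution on a
-- finite list (with multiplicity; our lists have no repetitions)
Pr : {A : Set} (xs : List A) {P : Pred A Agda.Primitive.lzero} → Decidable P → ℚ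
Pr xs P? = ratio (length (filter P? xs)) (length xs)

-- A permutation of [n] represented by the pair (σ , σ⁻¹) of its
-- value tables; each permutation corresponds to exactly one such pair.
PermData : ℕ → Set
PermData n = Vec (Fin n) n × Vec (Fin n) n

InSym : {n : ℕ} → Subset n → PermData n → Set
InSym J (σ , τ) =
  (∀ i → lookup τ (lookup σ i) ≡ i) ×
  (∀ j → lookup σ (lookup τ j) ≡ j) ×
  (∀ i → i ∉ J → lookup σ i ≡ i)

InSym? : {n : ℕ} (J : Subset n) → Decidable (InSym J)
InSym? J (σ , τ) =
  all? (λ i → lookup τ (lookup σ i) ≟ᶠ i) ×-dec
  (all? (λ j → lookup σ (lookup τ j) ≟ᶠ j) ×-dec
   all? (λ i → ¬? (i ∈? J) →-dec (lookup σ i ≟ᶠ i)))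

symGroup : {n : ℕ} → Subset n → List (PermData n)
symGroup {n} J = filter (InSym? J)
  (cartesianProduct (allVecs (allFin n) n) (allVecs (allFin n) n))

-- π x : the vector whose π(i)-th coordinate is x_i, i.e. (π x)_j = x_{π⁻¹(j)}
act : {n : ℕ} → PermData n → Cube n → Cube n
act (σ , τ) x = tabulate (λ j → lookup x (lookup τ j))

IsJSymmetric : {n : ℕ} → Subset n → (Cube n → Bool) → Set
IsJSymmetric J f = ∀ π → InSym J π → ∀ x → f (act π x) ≡ f x

IsTSymmetric : {n : ℕ} → ℕ → (Cube n → Bool) → Set
IsTSymmetric {n} t f = Σ (Subset n) (λ J → (t ≤ ∣ J ∣) × IsJSymmetric J f)

dist : {n : ℕ} → (Cube n → Bool) → (Cube n → Bool) → ℚ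
dist {n} f g = Pr (cube n) (λ x → ¬? (f x ≟ᵇ g x))

IsFarFromTSymmetric : {n : ℕ} → ℚ → ℕ → (Cube n → Bool) → Set
IsFarFromTSymmetric {n} ε t f =
  ∀ (g : Cube n → Bool) → IsTSymmetric t g → ε Data.Rational.≤ dist f g

SymInf : {n : ℕ} → (Cube n → Bool) → Subset n → ℚ
SymInf {n} f J = Pr (cartesianProduct (cube n) (symGroup J))
  (λ p → ¬? (f (proj₁ p) ≟ᵇ f (act (proj₂ p) (proj₁ p))))

module Submission where

-- Fix f and J with |J| ≥ t, and write G = S_J, m = |G|.  The
-- majority vote g(x) := the more frequent value among f(πx), π ∈ G, is
-- J-symmetric: for σ ∈ G the values f(π(σx)) = f((π∘σ)x) are those of x
-- re-indexed by the bijection π ↦ π∘σ of G.  So ε ≤ dist(f, g) by farness,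
-- and it remains to show dist(f, g) ≤ SymInf_f(J).  Averaging over σ ∈ G,
-- and using that x ↦ σx permutes the cube,
--   m · #{x : f x ≠ g x}        = Σ_x #{σ : f(σx) ≠ g x},
--   m · #{(x,π) : f x ≠ f(πx)}  = Σ_x #{(σ,ρ) : f(σx) ≠ f(ρx)},
-- and for each x the elementary majority bound
--   m · #{σ : f(σx) ≠ majority} ≤ #{(σ,ρ) : f(σx) ≠ f(ρx)}  (= 2·c₀·c₁)
-- compares the summands; dividing by m · 2ⁿ gives the claim.

open import Defs
open import Data.Nat using (ℕ; zero; suc; _+_; _*_; _≤_; _<_; _≤?_; z≤n; s≤s; >-nonZero)
open import Data.Nat.Properties
  using (+-assoc; +-comm; *-zeroʳ; *-identityʳ; *-comm; *-assoc; *-distribˡ-+;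
         *-distribʳ-+; +-mono-≤; +-monoʳ-≤; *-monoʳ-≤; *-cancelˡ-≤; ≰⇒>; <⇒≤;
         +-commutativeSemigroup; module ≤-Reasoning)
open import Algebra.Properties.CommutativeSemigroup +-commutativeSemigroup
  using (interchange; x∙yz≈y∙xz)
open import Data.Nat.ListAction using (sum)
open import Data.Nat.ListAction.Properties using (sum-++; sum-↭)
open import Data.Bool using (Bool; true; false; if_then_else_)
open import Data.Bool.Properties using () renaming (_≟_ to _≟ᵇ_)
open import Data.Empty using (⊥)
open import Data.Fin using (Fin)
open import Data.Fin.Subset using (Subset; ∣_∣)
open import Data.List
  using (List; []; _∷_; _++_; map; filter; length; cartesianProduct; concatMap; allFin)
open import Data.List.Properties using (map-++; length-++; length-map)
open import Data.List.Membership.Propositional using (_∈_)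
open import Data.List.Membership.Propositional.Properties
  using (∈-map⁺; ∈-map⁻; ∈-concat⁺′; ∈-concat⁻′; ∈-filter⁺; ∈-filter⁻;
         ∈-cartesianProduct⁺; ∈-allFin)
open import Data.List.Membership.Propositional.Properties.WithK using (unique∧set⇒bag)
open import Data.List.Relation.Unary.Any using (here; there)
import Data.List.Relation.Unary.All as All
import Data.List.Relation.Unary.AllPairs as AllPairs
open import Data.List.Relation.Unary.Unique.Propositional using (Unique)
import Data.List.Relation.Unary.Unique.Propositional.Properties as Unique
open import Data.List.Relation.Binary.Permutation.Propositional using (_↭_)
import Data.List.Relation.Binary.Permutation.Propositional.Properties as ↭
open import Data.List.Relation.Binary.BagAndSetEquality using (∼bag⇒↭)
open import Data.Product using (_×_; _,_; proj₁; proj₂)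
open import Data.Vec using (Vec; lookup; tabulate; replicate; head)
  renaming (_∷_ to _∷ᵥ_; [] to []ᵥ)
open import Data.Vec.Properties
  using (lookup∘tabulate; tabulate∘lookup; tabulate-cong; ∷-injectiveʳ)
import Data.Integer as ℤ
import Data.Integer.Properties as ℤP
open import Data.Rational using (ℚ) renaming (_≤_ to _≤ℚ_)
import Data.Rational.Properties as ℚP
open import Data.Rational.Unnormalised using (mkℚᵘ; *≤*)
import Data.Rational.Unnormalised.Properties as ℚᵘP
open import Function using (_∘_; id; mk⇔)
open import Relation.Binary.PropositionalEquality
open import Relation.Nullary using (Dec; ¬?; does; yes; no)
open import Relation.Unary using (Pred; Decidable)

-- Finite sums over lists

private
  variable
    A B : Set

sumL : List A → (A → ℕ) → ℕ
sumL xs F = sum (map F xs)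

sumL-cong-∈ : (xs : List A) {F G : A → ℕ} →
  (∀ {x} → x ∈ xs → F x ≡ G x) → sumL xs F ≡ sumL xs G
sumL-cong-∈ [] eq = refl
sumL-cong-∈ (x ∷ xs) eq = cong₂ _+_ (eq (here refl)) (sumL-cong-∈ xs (eq ∘ there))

sumL-cong : (xs : List A) {F G : A → ℕ} → (∀ x → F x ≡ G x) → sumL xs F ≡ sumL xs G
sumL-cong xs eq = sumL-cong-∈ xs (λ {x} _ → eq x)

sumL-mono : (xs : List A) {F G : A → ℕ} → (∀ x → F x ≤ G x) → sumL xs F ≤ sumL xs G
sumL-mono [] le = z≤n
sumL-mono (x ∷ xs) le = +-mono-≤ (le x) (sumL-mono xs le)

sumL-+ : (xs : List A) (F G : A → ℕ) →
  sumL xs (λ x → F x + G x) ≡ sumL xs F + sumL xs G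
sumL-+ [] F G = refl
sumL-+ (x ∷ xs) F G =
  trans (cong (F x + G x +_) (sumL-+ xs F G)) (interchange (F x) (G x) _ _)

sumL-zero : (xs : List A) → sumL xs (λ _ → 0) ≡ 0
sumL-zero [] = refl
sumL-zero (x ∷ xs) = sumL-zero xs

sumL-const : (xs : List A) (c : ℕ) → sumL xs (λ _ → c) ≡ length xs * c
sumL-const [] c = refl
sumL-const (x ∷ xs) c = cong (c +_) (sumL-const xs c)

sumL-*ˡ : (xs : List A) (c : ℕ) (F : A → ℕ) → sumL xs (λ x → c * F x) ≡ c * sumL xs F
sumL-*ˡ [] c F = sym (*-zeroʳ c)
sumL-*ˡ (x ∷ xs) c F =
  trans (cong (c * F x +_) (sumL-*ˡ xs c F)) (sym (*-distribˡ-+ c (F x) _))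

sumL-swap : (xs : List A) (ys : List B) (H : A → B → ℕ) →
  sumL xs (λ x → sumL ys (H x)) ≡ sumL ys (λ y → sumL xs (λ x → H x y))
sumL-swap [] ys H = sym (sumL-zero ys)
sumL-swap (x ∷ xs) ys H =
  trans (cong (sumL ys (H x) +_) (sumL-swap xs ys H))
        (sym (sumL-+ ys (H x) (λ y → sumL xs (λ x′ → H x′ y))))

sumL-map : (xs : List A) (h : A → B) (F : B → ℕ) →
  sumL (map h xs) F ≡ sumL xs (F ∘ h)
sumL-map [] h F = refl
sumL-map (x ∷ xs) h F = cong (F (h x) +_) (sumL-map xs h F)

sumL-cartesianProduct : (xs : List A) (ys : List B) (F : A × B → ℕ) →
  sumL (cartesianProduct xs ys) F ≡ sumL xs (λ x → sumL ys (λ y → F (x , y)))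
sumL-cartesianProduct [] ys F = refl
sumL-cartesianProduct (x ∷ xs) ys F = begin
  sumL (map (x ,_) ys ++ cartesianProduct xs ys) F
    ≡⟨ cong sum (map-++ F (map (x ,_) ys) _) ⟩
  sum (map F (map (x ,_) ys) ++ map F (cartesianProduct xs ys))
    ≡⟨ sum-++ (map F (map (x ,_) ys)) _ ⟩
  sumL (map (x ,_) ys) F + sumL (cartesianProduct xs ys) F
    ≡⟨ cong₂ _+_ (sumL-map ys (x ,_) F) (sumL-cartesianProduct xs ys F) ⟩
  sumL ys (λ y → F (x , y)) + sumL xs (λ x′ → sumL ys (λ y → F (x′ , y))) ∎
  where open ≡-Reasoning

sumL-↭ : {xs ys : List A} (F : A → ℕ) → xs ↭ ys → sumL xs F ≡ sumL ys F
sumL-↭ F p = sum-↭ (↭.map⁺ F p)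

sumL-reindex : (xs : List A) → Unique xs → (h k : A → A) →
  (∀ a → k (h a) ≡ a) → (∀ a → h (k a) ≡ a) →
  (∀ {a} → a ∈ xs → h a ∈ xs) → (∀ {a} → a ∈ xs → k a ∈ xs) →
  (F : A → ℕ) → sumL xs (F ∘ h) ≡ sumL xs F
sumL-reindex xs unique h k kh hk h∈ k∈ F =
  trans (sym (sumL-map xs h F)) (sumL-↭ F map-h↭id)
  where
  h-injective : ∀ {a b} → h a ≡ h b → a ≡ b
  h-injective {a} {b} e = trans (sym (kh a)) (trans (cong k e) (kh b))

  to : ∀ {z} → z ∈ map h xs → z ∈ xs
  to z∈ with ∈-map⁻ h z∈
  ... | a , a∈ , refl = h∈ a∈

  from : ∀ {z} → z ∈ xs → z ∈ map h xs
  from {z} z∈ = subst (_∈ map h xs) (hk z) (∈-map⁺ h (k∈ z∈))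

  map-h↭id : map h xs ↭ xs
  map-h↭id = ∼bag⇒↭ (unique∧set⇒bag (Unique.map⁺ h-injective unique) unique (mk⇔ to from))

indicator : {P : Set} → Dec P → ℕ
indicator d = if does d then 1 else 0

length-filter : {P : Pred A _} (P? : Decidable P) (xs : List A) →
  length (filter P? xs) ≡ sumL xs (indicator ∘ P?)
length-filter P? [] = refl
length-filter P? (x ∷ xs) with does (P? x)
... | true = cong suc (length-filter P? xs)
... | false = length-filter P? xs

length-cartesianProduct : (xs : List A) (ys : List B) →
  length (cartesianProduct xs ys) ≡ length xs * length ys
length-cartesianProduct [] ys = refl
length-cartesianProduct (x ∷ xs) ys =
  trans (length-++ (map (x ,_) ys))
        (cong₂ _+_ (length-map (x ,_) ys) (length-cartesianProduct xs ys))

nonEmpty : {z : A} {xs : List A} → z ∈ xs → 0 < length xs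
nonEmpty {xs = _ ∷ _} _ = s≤s z≤n

module _ {A : Set} (xs : List A) where

  allVecs-complete : (∀ a → a ∈ xs) → ∀ {n} (v : Vec A n) → v ∈ allVecs xs n
  allVecs-complete all∈ []ᵥ = here refl
  allVecs-complete all∈ {suc n} (a ∷ᵥ v) =
    ∈-concat⁺′ (∈-map⁺ (a ∷ᵥ_) (allVecs-complete all∈ v))
               (∈-map⁺ (λ b → map (b ∷ᵥ_) (allVecs xs n)) (all∈ a))

  head∈ : ∀ {n} (V : List (Vec A n)) (ys : List A) {v : Vec A (suc n)} →
    v ∈ concatMap (λ a → map (a ∷ᵥ_) V) ys → head v ∈ ys
  head∈ V ys v∈ with ∈-concat⁻′ (map (λ a → map (a ∷ᵥ_) V) ys) v∈
  ... | block , v∈block , block∈ with ∈-map⁻ (λ a → map (a ∷ᵥ_) V) block∈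
  ... | a , a∈ys , refl with ∈-map⁻ (a ∷ᵥ_) v∈block
  ... | _ , _ , refl = a∈ys

  allVecs-unique : Unique xs → ∀ n → Unique (allVecs xs n)
  allVecs-unique unique zero = All.[] AllPairs.∷ AllPairs.[]
  allVecs-unique unique (suc n) = prefixes-unique xs unique
    where
    V : List (Vec A n)
    V = allVecs xs n

    prefixes-unique : ∀ ys → Unique ys → Unique (concatMap (λ a → map (a ∷ᵥ_) V) ys)
    prefixes-unique [] _ = AllPairs.[]
    prefixes-unique (a ∷ ys) a∷ys-unique@(_ AllPairs.∷ ys-unique) =
      Unique.++⁺ (Unique.map⁺ ∷-injectiveʳ (allVecs-unique unique n))
                 (prefixes-unique ys ys-unique)
                 (λ (v∈a , v∈ys) → disjoint v∈a v∈ys)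
      where
      disjoint : ∀ {v} → v ∈ map (a ∷ᵥ_) V →
        v ∈ concatMap (λ a → map (a ∷ᵥ_) V) ys → ⊥
      disjoint v∈a v∈ys with ∈-map⁻ (a ∷ᵥ_) v∈a
      ... | _ , _ , refl = Unique.Unique[x∷xs]⇒x∉xs a∷ys-unique (head∈ V ys v∈ys)

cube-complete : ∀ {n} (x : Cube n) → x ∈ cube n
cube-complete = allVecs-complete _ λ { true → here refl ; false → there (here refl) }

cube-unique : ∀ n → Unique (cube n)
cube-unique = allVecs-unique _ (((λ ()) All.∷ All.[]) AllPairs.∷ (All.[] AllPairs.∷ AllPairs.[]))

-- Permutation tables: composition, inverse and action on the cube

module _ {n : ℕ} where

  -- (π ∘ₚ σ) acts as "first σ, then π" (see act-∘ below).
  _∘ₚ_ : PermData n → PermData n → PermData n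
  (σ₁ , τ₁) ∘ₚ (σ₂ , τ₂) =
    tabulate (λ i → lookup σ₁ (lookup σ₂ i)) , tabulate (λ j → lookup τ₂ (lookup τ₁ j))

  inverse : PermData n → PermData n
  inverse (σ , τ) = τ , σ

  identity : PermData n
  identity = tabulate id , tabulate id

  LeftInverse : PermData n → Set
  LeftInverse (σ , τ) = ∀ i → lookup τ (lookup σ i) ≡ i

  LeftInverse-∘ : ∀ π σ → LeftInverse π → LeftInverse σ → LeftInverse (π ∘ₚ σ)
  LeftInverse-∘ (σ₁ , τ₁) (σ₂ , τ₂) inv₁ inv₂ i = begin
    lookup (tabulate (λ j → lookup τ₂ (lookup τ₁ j))) (lookup (tabulate σ₁∘σ₂) i)
      ≡⟨ lookup∘tabulate (λ j → lookup τ₂ (lookup τ₁ j)) _ ⟩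
    lookup τ₂ (lookup τ₁ (lookup (tabulate σ₁∘σ₂) i))
      ≡⟨ cong (λ k → lookup τ₂ (lookup τ₁ k)) (lookup∘tabulate σ₁∘σ₂ i) ⟩
    lookup τ₂ (lookup τ₁ (lookup σ₁ (lookup σ₂ i)))
      ≡⟨ cong (lookup τ₂) (inv₁ _) ⟩
    lookup τ₂ (lookup σ₂ i)
      ≡⟨ inv₂ i ⟩
    i ∎
    where
    open ≡-Reasoning
    σ₁∘σ₂ : Fin n → Fin n
    σ₁∘σ₂ j = lookup σ₁ (lookup σ₂ j)

  act-∘ : ∀ π σ (x : Cube n) → act (π ∘ₚ σ) x ≡ act π (act σ x)
  act-∘ (σ₁ , τ₁) (σ₂ , τ₂) x = tabulate-cong λ j →
    trans (cong (lookup x) (lookup∘tabulate _ j)) (sym (lookup∘tabulate _ (lookup τ₁ j)))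

  act-cancel : ∀ π → LeftInverse π → ∀ x → act (inverse π) (act π x) ≡ x
  act-cancel (σ , τ) inv x = begin
    tabulate (λ i → lookup (tabulate _) (lookup σ i))
      ≡⟨ tabulate-cong (λ i → trans (lookup∘tabulate _ (lookup σ i)) (cong (lookup x) (inv i))) ⟩
    tabulate (lookup x)
      ≡⟨ tabulate∘lookup x ⟩
    x ∎
    where open ≡-Reasoning

  ∘ₚ-cancel : ∀ π → LeftInverse π → ∀ ρ → (ρ ∘ₚ inverse π) ∘ₚ π ≡ ρ
  ∘ₚ-cancel (σ , τ) inv (σρ , τρ) = cong₂ _,_
    (trans (tabulate-cong λ i →
              trans (lookup∘tabulate _ (lookup σ i)) (cong (lookup σρ) (inv i)))
           (tabulate∘lookup σρ))
    (trans (tabulate-cong λ j →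
              trans (cong (lookup τ) (lookup∘tabulate _ j)) (inv (lookup τρ j)))
           (tabulate∘lookup τρ))

-- The group S_J and invariance of sums under it

module SymmetricGroup {n : ℕ} (J : Subset n) where

  tables : List (Vec (Fin n) n)
  tables = allVecs (allFin n) n

  G : List (PermData n)
  G = symGroup J

  InSym-∘ : ∀ π σ → InSym J π → InSym J σ → InSym J (π ∘ₚ σ)
  InSym-∘ π σ (inv₁ , inv₁′ , fix₁) (inv₂ , inv₂′ , fix₂) =
    LeftInverse-∘ π σ inv₁ inv₂ ,
    LeftInverse-∘ (inverse σ) (inverse π) inv₂′ inv₁′ ,
    λ i i∉J → trans (lookup∘tabulate _ i)
                    (trans (cong (lookup (proj₁ π)) (fix₂ i i∉J)) (fix₁ i i∉J))

  InSym-inverse : ∀ π → InSym J π → InSym J (inverse π)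
  InSym-inverse π (inv , inv′ , fix) =
    inv′ , inv , λ i i∉J → trans (cong (lookup (proj₂ π)) (sym (fix i i∉J))) (inv i)

  InSym-identity : InSym J identity
  InSym-identity = id∘id , id∘id , (λ i _ → lookup∘tabulate id i)
    where
    id∘id : ∀ i → lookup (tabulate id) (lookup (tabulate id) i) ≡ i
    id∘id i = trans (lookup∘tabulate id _) (lookup∘tabulate id i)

  InSym⇒∈G : ∀ π → InSym J π → π ∈ G
  InSym⇒∈G (σ , τ) = ∈-filter⁺ (InSym? J)
    (∈-cartesianProduct⁺ (allVecs-complete _ ∈-allFin σ) (allVecs-complete _ ∈-allFin τ))

  ∈G⇒InSym : ∀ {π} → π ∈ G → InSym J π
  ∈G⇒InSym π∈G = proj₂ (∈-filter⁻ (InSym? J) {xs = cartesianProduct tables tables} π∈G)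

  G-unique : Unique G
  G-unique = Unique.filter⁺ (InSym? J)
    (Unique.cartesianProduct⁺ tables-unique tables-unique)
    where
    tables-unique : Unique tables
    tables-unique = allVecs-unique (allFin n) (Unique.allFin⁺ n) n

  |G|>0 : 0 < length G
  |G|>0 = nonEmpty (InSym⇒∈G identity InSym-identity)

  translation-invariant : ∀ σ → InSym J σ → (H : PermData n → ℕ) →
    sumL G (λ π → H (π ∘ₚ σ)) ≡ sumL G H
  translation-invariant σ σ∈ H = sumL-reindex G G-unique (_∘ₚ σ) (_∘ₚ inverse σ)
    (∘ₚ-cancel (inverse σ) (proj₁ (proj₂ σ∈))) (∘ₚ-cancel σ (proj₁ σ∈))
    (λ {π} π∈G → InSym⇒∈G _ (InSym-∘ π σ (∈G⇒InSym π∈G) σ∈))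
    (λ {π} π∈G → InSym⇒∈G _ (InSym-∘ π (inverse σ) (∈G⇒InSym π∈G) (InSym-inverse σ σ∈)))
    H

  cube-invariant : ∀ σ → InSym J σ → (h : Cube n → ℕ) →
    sumL (cube n) (h ∘ act σ) ≡ sumL (cube n) h
  cube-invariant σ σ∈ h = sumL-reindex (cube n) (cube-unique n) (act σ) (act (inverse σ))
    (act-cancel σ (proj₁ σ∈)) (act-cancel (inverse σ) (proj₁ (proj₂ σ∈)))
    (λ _ → cube-complete _) (λ _ → cube-complete _)
    h

  orbit-invariant : ∀ σ → InSym J σ → ∀ x (H : Cube n → ℕ) →
    sumL G (λ π → H (act π (act σ x))) ≡ sumL G (λ π → H (act π x))
  orbit-invariant σ σ∈ x H =
    trans (sumL-cong G (λ π → cong H (sym (act-∘ π σ x))))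
          (translation-invariant σ σ∈ (λ π → H (act π x)))

  average : (h : Cube n → ℕ) →
    length G * sumL (cube n) h ≡ sumL (cube n) (λ x → sumL G (λ σ → h (act σ x)))
  average h = begin
    length G * sumL (cube n) h
      ≡⟨ sym (sumL-const G _) ⟩
    sumL G (λ _ → sumL (cube n) h)
      ≡⟨ sumL-cong-∈ G (λ {σ} σ∈G → sym (cube-invariant σ (∈G⇒InSym σ∈G) h)) ⟩
    sumL G (λ σ → sumL (cube n) (h ∘ act σ))
      ≡⟨ sumL-swap G (cube n) (λ σ x → h (act σ x)) ⟩
    sumL (cube n) (λ x → sumL G (λ σ → h (act σ x))) ∎
    where open ≡-Reasoning

-- The majority bound

differ : Bool → Bool → ℕ
differ a b = indicator (¬? (a ≟ᵇ b))

differ-sym : ∀ a b → differ a b ≡ differ b a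
differ-sym true true = refl
differ-sym true false = refl
differ-sym false true = refl
differ-sym false false = refl

minority-mass : ∀ {a b} → a ≤ b → (a + b) * a ≤ b * a + a * b
minority-mass {a} {b} a≤b = begin
  (a + b) * a   ≡⟨ *-distribʳ-+ a a b ⟩
  a * a + b * a ≡⟨ +-comm (a * a) (b * a) ⟩
  b * a + a * a ≤⟨ +-monoʳ-≤ (b * a) (*-monoʳ-≤ a a≤b) ⟩
  b * a + a * b ∎
  where open ≤-Reasoning

module _ {A : Set} where

  mismatches : List A → (A → Bool) → Bool → ℕ
  mismatches xs b v = sumL xs (λ a → differ (b a) v)

  -- The more frequent label (ties go to true).
  majority : List A → (A → Bool) → Bool
  majority xs b = does (mismatches xs b true ≤? mismatches xs b false)

  sumL-split : (xs : List A) (b : A → Bool) (H : Bool → ℕ) →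
    sumL xs (H ∘ b) ≡ mismatches xs b false * H true + mismatches xs b true * H false
  sumL-split [] b H = refl
  sumL-split (x ∷ xs) b H = trans (cong (H (b x) +_) (sumL-split xs b H)) (step (b x))
    where
    #true #false : ℕ
    #true = mismatches xs b false
    #false = mismatches xs b true

    step : ∀ v → H v + (#true * H true + #false * H false) ≡
                 (differ v false + #true) * H true + (differ v true + #false) * H false
    step true = sym (+-assoc (H true) (#true * H true) (#false * H false))
    step false = x∙yz≈y∙xz (H false) (#true * H true) (#false * H false)

  majority-bound : (xs : List A) (b : A → Bool) →
    length xs * mismatches xs b (majority xs b) ≤
    sumL xs (λ a → sumL xs (λ a′ → differ (b a) (b a′)))
  majority-bound xs b =
    subst₂ _≤_ (cong₂ _*_ (sym length≡) (sym (mismatches-majority (majority xs b))))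
               (sym disagreements)
               (majority-mass c₀ c₁ (c₀ ≤? c₁))
    where
    c₀ c₁ : ℕ
    c₀ = mismatches xs b true
    c₁ = mismatches xs b false

    length≡ : length xs ≡ c₁ + c₀
    length≡ = begin
      length xs               ≡⟨ sym (*-identityʳ (length xs)) ⟩
      length xs * 1           ≡⟨ sym (sumL-const xs 1) ⟩
      sumL xs (λ _ → 1)       ≡⟨ sumL-split xs b (λ _ → 1) ⟩
      c₁ * 1 + c₀ * 1         ≡⟨ cong₂ _+_ (*-identityʳ c₁) (*-identityʳ c₀) ⟩
      c₁ + c₀                 ∎
      where open ≡-Reasoning

    disagreements : sumL xs (λ a → sumL xs (λ a′ → differ (b a) (b a′))) ≡ c₁ * c₀ + c₀ * c₁
    disagreements =
      trans (sumL-cong xs (λ a → sumL-cong xs (λ a′ → differ-sym (b a) (b a′))))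
            (sumL-split xs b (mismatches xs b))

    mismatches-majority : ∀ v → mismatches xs b v ≡ (if v then c₀ else c₁)
    mismatches-majority true = refl
    mismatches-majority false = refl

    majority-mass : ∀ a b (a≤?b : Dec (a ≤ b)) →
      (b + a) * (if does a≤?b then a else b) ≤ b * a + a * b
    majority-mass a b (yes a≤b) =
      subst (_≤ b * a + a * b) (cong (_* a) (+-comm a b)) (minority-mass a≤b)
    majority-mass a b (no a≰b) =
      subst ((b + a) * b ≤_) (+-comm (a * b) (b * a)) (minority-mass (<⇒≤ (≰⇒> a≰b)))

ratio-mono : ∀ {a b c e} → 0 < c → 0 < e → a * e ≤ b * c → ratio a c ≤ℚ ratio b e
ratio-mono {a} {b} {suc c} {suc e} _ _ ae≤bc = ℚP.toℚᵘ-cancel-≤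
  (ℚᵘP.≤-respˡ-≃ (ℚᵘP.≃-sym (ℚP.toℚᵘ-fromℚᵘ (mkℚᵘ (ℤ.+ a) c)))
  (ℚᵘP.≤-respʳ-≃ (ℚᵘP.≃-sym (ℚP.toℚᵘ-fromℚᵘ (mkℚᵘ (ℤ.+ b) e)))
    (*≤* (subst₂ ℤ._≤_ (ℤP.pos-* a (suc e)) (ℤP.pos-* b (suc c)) (ℤ.+≤+ ae≤bc)))))

-- Symmetrisation by majority vote

module Symmetrisation {n : ℕ} (f : Cube n → Bool) (J : Subset n) where

  open SymmetricGroup J

  orbitValues : Cube n → PermData n → Bool
  orbitValues x π = f (act π x)

  majorityVote : Cube n → Bool
  majorityVote x = majority G (orbitValues x)

  majorityVote-symmetric : IsJSymmetric J majorityVote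
  majorityVote-symmetric σ σ∈ x =
    cong₂ (λ c₀ c₁ → does (c₀ ≤? c₁)) (same-counts true) (same-counts false)
    where
    same-counts : ∀ v → mismatches G (orbitValues (act σ x)) v ≡ mismatches G (orbitValues x) v
    same-counts v = orbit-invariant σ σ∈ x (λ y → differ (f y) v)

  -- Numerators of dist f majorityVote and of SymInf f J.
  disagreementsWithVote : ℕ
  disagreementsWithVote = sumL (cube n) (λ x → differ (f x) (majorityVote x))

  symDisagreements : ℕ
  symDisagreements = sumL (cube n) (λ x → sumL G (λ π → differ (f x) (f (act π x))))

  -- Averaging both numerators over G (the vote is constant on orbits).
  averaged-vote : length G * disagreementsWithVote ≡
    sumL (cube n) (λ x → mismatches G (orbitValues x) (majorityVote x))
  averaged-vote = trans (average _) (sumL-cong (cube n) λ x → sumL-cong-∈ G λ {σ} σ∈G →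
    cong (differ (f (act σ x))) (majorityVote-symmetric σ (∈G⇒InSym σ∈G) x))

  averaged-sym : length G * symDisagreements ≡
    sumL (cube n) (λ x → sumL G (λ σ → sumL G (λ ρ → differ (f (act σ x)) (f (act ρ x)))))
  averaged-sym = trans (average _) (sumL-cong (cube n) λ x → sumL-cong-∈ G λ {σ} σ∈G →
    orbit-invariant σ (∈G⇒InSym σ∈G) x (λ y → differ (f (act σ x)) (f y)))

  vote≤sym : length G * disagreementsWithVote ≤ symDisagreements
  vote≤sym = *-cancelˡ-≤ (length G) ⦃ >-nonZero |G|>0 ⦄ (begin
    length G * (length G * disagreementsWithVote)
      ≡⟨ cong (length G *_) averaged-vote ⟩
    length G * sumL (cube n) (λ x → mismatches G (orbitValues x) (majorityVote x))
      ≡⟨ sym (sumL-*ˡ (cube n) (length G) _) ⟩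
    sumL (cube n) (λ x → length G * mismatches G (orbitValues x) (majorityVote x))
      ≤⟨ sumL-mono (cube n) (λ x → majority-bound G (orbitValues x)) ⟩
    sumL (cube n) (λ x → sumL G (λ σ → sumL G (λ ρ → differ (f (act σ x)) (f (act ρ x)))))
      ≡⟨ sym averaged-sym ⟩
    length G * symDisagreements ∎)
    where open ≤-Reasoning

  dist≡ : dist f majorityVote ≡ ratio disagreementsWithVote (length (cube n))
  dist≡ = cong (λ k → ratio k (length (cube n)))
               (length-filter (λ x → ¬? (f x ≟ᵇ majorityVote x)) (cube n))

  SymInf≡ : SymInf f J ≡ ratio symDisagreements (length (cube n) * length G)
  SymInf≡ = cong₂ ratio
    (trans (length-filter _ (cartesianProduct (cube n) G))
           (sumL-cartesianProduct (cube n) G _))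
    (length-cartesianProduct (cube n) G)

  dist≤SymInf : dist f majorityVote ≤ℚ SymInf f J
  dist≤SymInf = subst₂ _≤ℚ_ (sym dist≡) (sym SymInf≡)
    (ratio-mono |cube|>0 (*-positive |cube|>0 |G|>0) cross-multiplied)
    where
    |cube|>0 : 0 < length (cube n)
    |cube|>0 = nonEmpty (cube-complete (replicate n false))

    *-positive : ∀ {a b} → 0 < a → 0 < b → 0 < a * b
    *-positive {suc a} {suc b} _ _ = s≤s z≤n

    N D S : ℕ
    N = length (cube n)
    D = disagreementsWithVote
    S = symDisagreements

    cross-multiplied : D * (N * length G) ≤ S * N
    cross-multiplied = subst₂ _≤_
      (trans (sym (*-assoc N (length G) D)) (*-comm (N * length G) D))
      (*-comm N S)
      (*-monoʳ-≤ N vote≤sym)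

corollary1 : (n : ℕ) (f : Cube n → Bool) (ε : ℚ) (t : ℕ) →
    IsFarFromTSymmetric ε t f →
    (J : Subset n) → t ≤ ∣ J ∣ → ε ≤ℚ SymInf f J
corollary1 n f ε t far J t≤∣J∣ =
  ℚP.≤-trans (far majorityVote (J , t≤∣J∣ , majorityVote-symmetric)) dist≤SymInf
  where open Symmetrisation f J
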